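{- Let $q\geq 4$ and let $a,b$ be positive integers. The sequence $\{R_n\}_{n\ge 0}$ of numbers of colored tilings of the $(2\times n)$-boards of the mosaic $\{4,q\}$ satisfies the fourth order linear homogeneous recurrence $$R_n=\alpha_q R_{n-1}+\beta_q R_{n-2}+\gamma_q R_{n-3}-b^{2(q-2)}R_{n-4}\qquad (n\geq 4),$$ where the coefficients $\alpha_q,\beta_q,\gamma_q$ (depending on $q$, $a$, $b$) are determined for all $q\ge 4$ by $$\alpha_{q+2}=a\alpha_{q+1}+b\alpha_q,\qquad \beta_{q+3}=(a^2+b)\beta_{q+2}+b(a^2+b)\beta_{q+1}-b^3\beta_q,\qquad \gamma_{q+2}=-ab\gamma_{q+1}+b^3\gamma_q$$ with initial values $\alpha_4=a^2+b$, $\alpha_5=a(a^2+3b)$, $\beta_4=2b(a^2+b)$, $\beta_5=b(a^2+b)(a^2+2b)$, $\beta_6=b(a^6+6a^4b+10a^2b^2+2b^3)$, $\gamma_4=b^2(a^2-b)$, $\gamma_5=-ab^3(a^2+b)$. Moreover $R_0=1$, $R_1=u_{q-2}$, $R_2=u_{q-2}^2+abu_{q-4}u_{q-3}+bu_{q-3}^2+b^2u_{q-4}^2$, and $$R_3=(u_{q-2}^2+2abu_{q-4}u_{q-3}+2bu_{q-3}^2+2b^2u_{q-4}^2)u_{q-2}+b^2\big(u_{q-3}u_{q-4}+(a^2+b)u_{q-4}u_{q-5}+au_{q-4}^2\big)u_{q-3}+ab^3u_{q-4}^2u_{q-5}.$$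
   Context: Let $q\ge 4$ be an integer and consider the regular square mosaic $\{4,q\}$ (Schläfli symbol), i.e. the tiling of the Euclidean plane ($q=4$) or of the hyperbolic plane ($q\ge5$) by congruent regular squares with $q$ squares around each vertex. For $n\ge1$ the $(2\times n)$-board is defined as follows. Choose a square $S_1$ of the mosaic with vertices $A_0,A_1,B_1,B_0$ in cyclic order. Inductively, for $i\ge1$ let $S_{i+1}$ be the other square of the mosaic containing the edge $A_iB_i$, with vertices $A_i,A_{i+1},B_{i+1},B_i$ in cyclic order. The first level of the board consists of $S_1,\dots,S_n$; the second level consists of all squares of the mosaic having at least one vertex in $\{A_1,\dots,A_n\}$ and no vertex in $\{B_1,\dots,B_n,A_{n+1}\}$ (here $A_{n+1}$ is the vertex of $S_{n+1}$); it has $n(q-3)$ squares. The board is the union of both levels. A domino is a pair of squares of the board sharing an edge. Given positive integers $a,b$, a colored tiling of the board is a partition of its squares into single squares and dominoes, each single square receiving one of $a$ colors and each domino one of $b$ colors. $R_n$ denotes the number of colored tilings of the $(2\times n)$-board for $n\ge1$, and $R_0=1$. The sequence $u_n$ is defined by $u_{ -1}=0$, $u_0=1$, $u_n=au_{n-1}+bu_{n-2}$ for $n\ge1$ (so $u_1=a$). -}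

module Defs where

open import Data.Nat using (ℕ; zero; suc; _+_; _*_; _∸_; _^_; _≡ᵇ_)
open import Data.Bool using (Bool; true; false; _∧_; not)
open import Data.Product using (_×_; _,_)
open import Data.List using (List; []; _∷_; _++_; map; upTo; length; filterᵇ)
open import Data.Nat.ListAction using (sum)
open import Data.Integer as ℤ using (ℤ; +_)

-- Squares are labelled by natural numbers 0 … n + n(q-3) - 1:
--   label i       (i < n)         is the first-level square S_{i+1};
--   label n + j   (j < n(q-3))    is the j-th square of the second level,
-- where the second level is listed in the cyclic order around A_1, …, A_n:
--   T_i , X_{i,q-4} , … , X_{i,1}   (block i, of size q-3), i = 1 … n,
-- T_i being the square sharing the edge A_{i-1}A_i with S_i and X_{i,k}
-- the remaining squares around A_i.

boardSize : ℕ → ℕ → ℕ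
boardSize q n = n + n * (q ∸ 3)

boardEdges : ℕ → ℕ → List (ℕ × ℕ)
boardEdges q n =
     map (λ i → i , suc i) (upTo (n ∸ 1))
  ++ map (λ j → n + j , n + suc j) (upTo (n * (q ∸ 3) ∸ 1))
  ++ map (λ i → i , n + i * (q ∸ 3)) (upTo n)                            -- S_i T_i

-- Tilings: a tiling by squares and dominoes is the same as a set of
-- pairwise disjoint dominoes (edges); the remaining squares are singles.

sublists : {A : Set} → List A → List (List A)
sublists [] = [] ∷ []
sublists (x ∷ xs) = let r = sublists xs in map (x ∷_) r ++ r

disjointᵇ : ℕ × ℕ → ℕ × ℕ → Bool
disjointᵇ (x , y) (z , w) =
  not (x ≡ᵇ z) ∧ not (x ≡ᵇ w) ∧ not (y ≡ᵇ z) ∧ not (y ≡ᵇ w)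

allᵇ : {A : Set} → (A → Bool) → List A → Bool
allᵇ p [] = true
allᵇ p (x ∷ xs) = p x ∧ allᵇ p xs

isMatchingᵇ : List (ℕ × ℕ) → Bool
isMatchingᵇ [] = true
isMatchingᵇ (e ∷ es) = allᵇ (disjointᵇ e) es ∧ isMatchingᵇ es

tilings : ℕ → ℕ → List (List (ℕ × ℕ))
tilings q n = filterᵇ isMatchingᵇ (sublists (boardEdges q n))

colourings : ℕ → ℕ → ℕ → ℕ → List (ℕ × ℕ) → ℕ
colourings a b q n M = a ^ (boardSize q n ∸ 2 * length M) * b ^ length M

-- R_n : number of coloured tilings of the (2×n)-board of {4,q}
-- (for n = 0 this evaluates to 1, the paper's convention R_0 = 1)
R : ℕ → ℕ → ℕ → ℕ → ℕ
R a b q n = sum (map (colourings a b q n) (tilings q n))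

-- u_n :  u_{-1} = 0, u_0 = 1, u_n = a u_{n-1} + b u_{n-2}.
-- Because of the index -1 we define  u₋ a b m = u_{m-1}.
u₋ : ℤ → ℤ → ℕ → ℤ
u₋ a b zero = + 0
u₋ a b (suc zero) = + 1
u₋ a b (suc (suc m)) = a ℤ.* u₋ a b (suc m) ℤ.+ b ℤ.* u₋ a b m

u : ℤ → ℤ → ℕ → ℤ
u a b n = u₋ a b (suc n)

-- Coefficients, indexed from q = 4:  αs a b k = α_{k+4}, etc.

αs : ℤ → ℤ → ℕ → ℤ
αs a b zero = a ℤ.* a ℤ.+ b
αs a b (suc zero) = a ℤ.* (a ℤ.* a ℤ.+ + 3 ℤ.* b)
αs a b (suc (suc k)) = a ℤ.* αs a b (suc k) ℤ.+ b ℤ.* αs a b k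

βs : ℤ → ℤ → ℕ → ℤ
βs a b zero = + 2 ℤ.* b ℤ.* (a ℤ.* a ℤ.+ b)
βs a b (suc zero) = b ℤ.* (a ℤ.* a ℤ.+ b) ℤ.* (a ℤ.* a ℤ.+ + 2 ℤ.* b)
βs a b (suc (suc zero)) =
  b ℤ.* (a ℤ.^ 6 ℤ.+ + 6 ℤ.* a ℤ.^ 4 ℤ.* b ℤ.+ + 10 ℤ.* a ℤ.^ 2 ℤ.* b ℤ.^ 2
         ℤ.+ + 2 ℤ.* b ℤ.^ 3)
βs a b (suc (suc (suc k))) =
  (a ℤ.* a ℤ.+ b) ℤ.* βs a b (suc (suc k))
  ℤ.+ b ℤ.* (a ℤ.* a ℤ.+ b) ℤ.* βs a b (suc k)
  ℤ.- b ℤ.^ 3 ℤ.* βs a b k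

γs : ℤ → ℤ → ℕ → ℤ
γs a b zero = b ℤ.^ 2 ℤ.* (a ℤ.* a ℤ.- b)
γs a b (suc zero) = ℤ.- (a ℤ.* b ℤ.^ 3 ℤ.* (a ℤ.* a ℤ.+ b))
γs a b (suc (suc k)) = ℤ.- (a ℤ.* b) ℤ.* γs a b (suc k) ℤ.+ b ℤ.^ 3 ℤ.* γs a b k

α β γ : ℤ → ℤ → ℕ → ℤ
α a b q = αs a b (q ∸ 4)
β a b q = βs a b (q ∸ 4)
γ a b q = γs a b (q ∸ 4)

Rℤ : ℕ → ℕ → ℕ → ℕ → ℤ
Rℤ a b q n = + R a b q n

module Submission where

-- Squares are vertices and dominoes edges, so R_n is the weighted matching sum
-- Σ_M a^(#uncovered squares) b^|M| of the board graph: a path of n first-level squares,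
-- a path of n (q - 3) second-level squares, and a rung from the i-th first-level square
-- to the first square of the i-th block of q - 3 second-level squares. Deciding the edges
-- one column at a time, from the first, gives a transfer recursion for the counts of the
-- last k columns, indexed by whether their first first-level and first second-level
-- squares are already covered; a block contributes the path numbers u_(q-4), u_(q-5).
-- Over ℤ the pair z_k of counts with the first-level square free satisfies
-- z_(k+2) = X z_(k+1) + H z_k for 2 × 2 matrices X, H, hence R_k obeys the fourth order
-- recurrence given by det (λ² - λ X - H): α = tr X, β = tr H - det X, γ is minus the mixed
-- determinant of X and H, and det H = b⁴ (u_(q-4)² - a u_(q-4) u_(q-5) - b u_(q-5)²)² = b^(2(q-2))
-- by Cassini's identity. As polynomials in u_(q-4), u_(q-5), the coefficients α, β, γ
-- satisfy the stated recurrences in q.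

module MatchingSums where

  open import Defs
  open import Data.Nat using (ℕ; zero; suc; _+_; _*_; _≡ᵇ_)
  open import Data.Nat.Properties using (+-assoc; *-zeroʳ; *-distribˡ-+; +-identityʳ)
  open import Data.Bool using (Bool; true; false; _∧_; _∨_; not; if_then_else_)
  open import Data.Bool.Properties using (∧-zeroʳ)
  open import Data.Bool.Solver using (module ∨-∧-Solver)
  open import Data.Product using (_×_; _,_)
  open import Data.List using (List; []; _∷_; _++_; map; length; filterᵇ)
  open import Data.Nat.ListAction using (sum)
  open import Data.List.Relation.Binary.Permutation.Propositional using (_↭_; refl; prep; swap; trans)
  open import Function using (_∘_)
  open import Data.Nat.Tactic.RingSolver using (solve-∀)
  open import Relation.Binary.PropositionalEquality hiding (trans)
  import Relation.Binary.PropositionalEquality as ≡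
  open ≡-Reasoning

  Edge : Set
  Edge = ℕ × ℕ

  Cover : Set
  Cover = ℕ → Bool

  _∪_ : Cover → Edge → Cover
  (c ∪ (x , y)) z = c z ∨ ((z ≡ᵇ x) ∨ (z ≡ᵇ y))

  free : Cover → Edge → Bool
  free c (x , y) = not (c x) ∧ not (c y)

  covered₁⇒¬free : ∀ c {x y} → c x ≡ true → free c (x , y) ≡ false
  covered₁⇒¬free c c[x] rewrite c[x] = refl

  covered₂⇒¬free : ∀ c {x y} → c y ≡ true → free c (x , y) ≡ false
  covered₂⇒¬free c {x} c[y] rewrite c[y] = ∧-zeroʳ (not (c x))

  uncovered⇒free : ∀ c {x y} → c x ≡ false → c y ≡ false → free c (x , y) ≡ true
  uncovered⇒free c c[x] c[y] rewrite c[x] | c[y] = refl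

  matchingSum : Cover → List Edge → (ℕ → ℕ) → ℕ
  matchingSum c [] f = f 0
  matchingSum c (e ∷ E) f =
    (if free c e then matchingSum (c ∪ e) E (f ∘ suc) else 0) + matchingSum c E f

  ≡ᵇ-sym : ∀ m n → (m ≡ᵇ n) ≡ (n ≡ᵇ m)
  ≡ᵇ-sym zero    zero    = refl
  ≡ᵇ-sym zero    (suc n) = refl
  ≡ᵇ-sym (suc m) zero    = refl
  ≡ᵇ-sym (suc m) (suc n) = ≡ᵇ-sym m n

  not-∨ : ∀ p q → not (p ∨ q) ≡ not p ∧ not q
  not-∨ true  q = refl
  not-∨ false q = refl

  free-∪ : ∀ c x e → free (c ∪ x) e ≡ free c e ∧ disjointᵇ x e
  free-∪ c (x₁ , x₂) (z , w)
    rewrite not-∨ (c z) ((z ≡ᵇ x₁) ∨ (z ≡ᵇ x₂)) | not-∨ (z ≡ᵇ x₁) (z ≡ᵇ x₂)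
          | not-∨ (c w) ((w ≡ᵇ x₁) ∨ (w ≡ᵇ x₂)) | not-∨ (w ≡ᵇ x₁) (w ≡ᵇ x₂)
          | ≡ᵇ-sym z x₁ | ≡ᵇ-sym z x₂ | ≡ᵇ-sym w x₁ | ≡ᵇ-sym w x₂
    = solve 6 (λ p q r s t u → (p :* (r :* s)) :* (q :* (t :* u))
                              := (p :* q) :* (r :* (t :* (s :* u)))) refl
        (not (c z)) (not (c w)) (not (x₁ ≡ᵇ z)) (not (x₂ ≡ᵇ z)) (not (x₁ ≡ᵇ w)) (not (x₂ ≡ᵇ w))
    where open ∨-∧-Solver

  avoids : Cover → List Edge → Bool
  avoids c M = allᵇ (free c) M ∧ isMatchingᵇ M

  allᵇ-∧ : ∀ {A : Set} (p q : A → Bool) xs → allᵇ (λ x → p x ∧ q x) xs ≡ allᵇ p xs ∧ allᵇ q xs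
  allᵇ-∧ p q [] = refl
  allᵇ-∧ p q (x ∷ xs) rewrite allᵇ-∧ p q xs =
    solve 4 (λ a b c d → (a :* b) :* (c :* d) := (a :* c) :* (b :* d)) refl
      (p x) (q x) (allᵇ p xs) (allᵇ q xs)
    where open ∨-∧-Solver

  allᵇ-cong : ∀ {A : Set} {p q : A → Bool} xs → (∀ x → p x ≡ q x) → allᵇ p xs ≡ allᵇ q xs
  allᵇ-cong []       p≗q = refl
  allᵇ-cong (x ∷ xs) p≗q = cong₂ _∧_ (p≗q x) (allᵇ-cong xs p≗q)

  avoids-∷ : ∀ c e M → avoids c (e ∷ M) ≡ free c e ∧ avoids (c ∪ e) M
  avoids-∷ c e M
    rewrite allᵇ-cong M (free-∪ c e) | allᵇ-∧ (free c) (disjointᵇ e) M =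
    solve 4 (λ a b c d → (a :* b) :* (c :* d) := a :* ((b :* c) :* d)) refl
      (free c e) (allᵇ (free c) M) (allᵇ (disjointᵇ e) M) (isMatchingᵇ M)
    where open ∨-∧-Solver

  sumWhere : {A : Set} → (A → Bool) → (A → ℕ) → List A → ℕ
  sumWhere P w []       = 0
  sumWhere P w (x ∷ xs) = (if P x then w x else 0) + sumWhere P w xs

  sum-map-filterᵇ : ∀ {A : Set} (P : A → Bool) w xs → sum (map w (filterᵇ P xs)) ≡ sumWhere P w xs
  sum-map-filterᵇ P w [] = refl
  sum-map-filterᵇ P w (x ∷ xs) with P x
  ... | true  = cong (w x +_) (sum-map-filterᵇ P w xs)
  ... | false = sum-map-filterᵇ P w xs

  sumWhere-++ : ∀ {A : Set} (P : A → Bool) w xs ys →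
                sumWhere P w (xs ++ ys) ≡ sumWhere P w xs + sumWhere P w ys
  sumWhere-++ P w []       ys = refl
  sumWhere-++ P w (x ∷ xs) ys =
    ≡.trans (cong (_ +_) (sumWhere-++ P w xs ys)) (sym (+-assoc (if P x then w x else 0) _ _))

  sumWhere-map : ∀ {A B : Set} (P : B → Bool) w (g : A → B) xs →
                 sumWhere P w (map g xs) ≡ sumWhere (P ∘ g) (w ∘ g) xs
  sumWhere-map P w g []       = refl
  sumWhere-map P w g (x ∷ xs) = cong (_ +_) (sumWhere-map P w g xs)

  sumWhere-cong : ∀ {A : Set} {P Q : A → Bool} {w} xs → (∀ x → P x ≡ Q x) → sumWhere P w xs ≡ sumWhere Q w xs
  sumWhere-cong []       P≗Q = refl
  sumWhere-cong (x ∷ xs) P≗Q = cong₂ (λ b s → (if b then _ else 0) + s) (P≗Q x) (sumWhere-cong xs P≗Q)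

  sumWhere-∧ : ∀ {A : Set} b (P : A → Bool) w xs →
               sumWhere (λ x → b ∧ P x) w xs ≡ (if b then sumWhere P w xs else 0)
  sumWhere-∧ true  P w xs       = refl
  sumWhere-∧ false P w []       = refl
  sumWhere-∧ false P w (x ∷ xs) = sumWhere-∧ false P w xs

  sumWhere-sublists : ∀ c E f → sumWhere (avoids c) (f ∘ length) (sublists E) ≡ matchingSum c E f
  sumWhere-sublists c []      f = +-identityʳ (f 0)
  sumWhere-sublists c (e ∷ E) f = begin
    sumWhere (avoids c) (f ∘ length) (map (e ∷_) (sublists E) ++ sublists E)
      ≡⟨ sumWhere-++ (avoids c) _ (map (e ∷_) (sublists E)) (sublists E) ⟩
    sumWhere (avoids c) (f ∘ length) (map (e ∷_) (sublists E)) + sumWhere (avoids c) (f ∘ length) (sublists E)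
      ≡⟨ cong₂ _+_ with-e (sumWhere-sublists c E f) ⟩
    matchingSum c (e ∷ E) f ∎
    where
    with-e : sumWhere (avoids c) (f ∘ length) (map (e ∷_) (sublists E))
           ≡ (if free c e then matchingSum (c ∪ e) E (f ∘ suc) else 0)
    with-e = begin
      sumWhere (avoids c) (f ∘ length) (map (e ∷_) (sublists E))
        ≡⟨ sumWhere-map (avoids c) _ (e ∷_) (sublists E) ⟩
      sumWhere (λ M → avoids c (e ∷ M)) (f ∘ suc ∘ length) (sublists E)
        ≡⟨ sumWhere-cong (sublists E) (avoids-∷ c e) ⟩
      sumWhere (λ M → free c e ∧ avoids (c ∪ e) M) (f ∘ suc ∘ length) (sublists E)
        ≡⟨ sumWhere-∧ (free c e) (avoids (c ∪ e)) _ (sublists E) ⟩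
      (if free c e then sumWhere (avoids (c ∪ e)) (f ∘ suc ∘ length) (sublists E) else 0)
        ≡⟨ cong (λ s → if free c e then s else 0) (sumWhere-sublists (c ∪ e) E (f ∘ suc)) ⟩
      (if free c e then matchingSum (c ∪ e) E (f ∘ suc) else 0) ∎

  disjointᵇ-sym : ∀ x y → disjointᵇ x y ≡ disjointᵇ y x
  disjointᵇ-sym (x₁ , x₂) (y₁ , y₂)
    rewrite ≡ᵇ-sym y₁ x₁ | ≡ᵇ-sym y₁ x₂ | ≡ᵇ-sym y₂ x₁ | ≡ᵇ-sym y₂ x₂ =
    solve 4 (λ p q r s → p :* (q :* (r :* s)) := p :* (r :* (q :* s))) refl
      (not (x₁ ≡ᵇ y₁)) (not (x₁ ≡ᵇ y₂)) (not (x₂ ≡ᵇ y₁)) (not (x₂ ≡ᵇ y₂))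
    where open ∨-∧-Solver

  free-∪-comm : ∀ c x y → free c x ∧ free (c ∪ x) y ≡ free c y ∧ free (c ∪ y) x
  free-∪-comm c x y rewrite free-∪ c x y | free-∪ c y x | disjointᵇ-sym x y =
    solve 3 (λ p q r → p :* (q :* r) := q :* (p :* r)) refl (free c x) (free c y) (disjointᵇ y x)
    where open ∨-∧-Solver

  ∪-comm : ∀ c x y z → ((c ∪ x) ∪ y) z ≡ ((c ∪ y) ∪ x) z
  ∪-comm c (x₁ , x₂) (y₁ , y₂) z =
    solve 3 (λ p q r → (p :+ q) :+ r := (p :+ r) :+ q) refl
      (c z) ((z ≡ᵇ x₁) ∨ (z ≡ᵇ x₂)) ((z ≡ᵇ y₁) ∨ (z ≡ᵇ y₂))
    where open ∨-∧-Solver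

  matchingSum-cong : ∀ {c c′} E {f g} → (∀ z → c z ≡ c′ z) → (∀ k → f k ≡ g k) →
                     matchingSum c E f ≡ matchingSum c′ E g
  matchingSum-cong []            c≗c′ f≗g = f≗g 0
  matchingSum-cong ((x , y) ∷ E) c≗c′ f≗g =
    cong₂ _+_
      (cong₂ (λ b s → if b then s else 0)
        (cong₂ (λ p q → not p ∧ not q) (c≗c′ x) (c≗c′ y))
        (matchingSum-cong E (λ z → cong (_∨ _) (c≗c′ z)) (f≗g ∘ suc)))
      (matchingSum-cong E c≗c′ f≗g)

  if-*ʳ : ∀ b k n → (if b then k * n else 0) ≡ k * (if b then n else 0)
  if-*ʳ true  k n = refl
  if-*ʳ false k n = sym (*-zeroʳ k)

  matchingSum-* : ∀ c E f k → matchingSum c E (λ i → k * f i) ≡ k * matchingSum c E f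
  matchingSum-* c []      f k = refl
  matchingSum-* c (e ∷ E) f k = begin
    (if free c e then matchingSum (c ∪ e) E (λ i → k * f (suc i)) else 0) + matchingSum c E (λ i → k * f i)
      ≡⟨ cong₂ (λ s t → (if free c e then s else 0) + t)
               (matchingSum-* (c ∪ e) E (f ∘ suc) k) (matchingSum-* c E f k) ⟩
    (if free c e then k * matchingSum (c ∪ e) E (f ∘ suc) else 0) + k * matchingSum c E f
      ≡⟨ cong (_+ k * matchingSum c E f) (if-*ʳ (free c e) k _) ⟩
    k * (if free c e then matchingSum (c ∪ e) E (f ∘ suc) else 0) + k * matchingSum c E f
      ≡⟨ sym (*-distribˡ-+ k _ _) ⟩
    k * matchingSum c (e ∷ E) f ∎

  if-+ : ∀ a b Z X → (if a then (if b then Z else 0) + X else 0) ≡ (if a ∧ b then Z else 0) + (if a then X else 0)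
  if-+ true  b Z X = refl
  if-+ false b Z X = refl

  matchingSum-swap : ∀ c x y E f → matchingSum c (x ∷ y ∷ E) f ≡ matchingSum c (y ∷ x ∷ E) f
  matchingSum-swap c x y E f = begin
    (if free c x then Zx + X else 0) + (Y? + S)
      ≡⟨ cong (_+ (Y? + S)) (if-+ (free c x) (free (c ∪ x) y) Zxy X) ⟩
    (if free c x ∧ free (c ∪ x) y then Zxy else 0) + X? + (Y? + S)
      ≡⟨ cong (λ t → t + X? + (Y? + S))
              (cong₂ (λ b s → if b then s else 0) (free-∪-comm c x y) (matchingSum-cong E (∪-comm c x y) λ _ → refl)) ⟩
    (if free c y ∧ free (c ∪ y) x then Zyx else 0) + X? + (Y? + S)
      ≡⟨ interchange (if free c y ∧ free (c ∪ y) x then Zyx else 0) X? Y? S ⟩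
    (if free c y ∧ free (c ∪ y) x then Zyx else 0) + Y? + (X? + S)
      ≡⟨ cong (_+ (X? + S)) (sym (if-+ (free c y) (free (c ∪ y) x) Zyx Y)) ⟩
    (if free c y then Zy + Y else 0) + (X? + S) ∎
    where
    X = matchingSum (c ∪ x) E (f ∘ suc)
    Y = matchingSum (c ∪ y) E (f ∘ suc)
    X? = if free c x then X else 0
    Y? = if free c y then Y else 0
    S = matchingSum c E f
    Zxy = matchingSum ((c ∪ x) ∪ y) E (f ∘ suc ∘ suc)
    Zyx = matchingSum ((c ∪ y) ∪ x) E (f ∘ suc ∘ suc)
    Zx = if free (c ∪ x) y then Zxy else 0
    Zy = if free (c ∪ y) x then Zyx else 0
    interchange : ∀ p q r s → p + q + (r + s) ≡ p + r + (q + s)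
    interchange = solve-∀

  matchingSum-∷ : ∀ e E E′ → (∀ c f → matchingSum c E f ≡ matchingSum c E′ f) →
                  ∀ c f → matchingSum c (e ∷ E) f ≡ matchingSum c (e ∷ E′) f
  matchingSum-∷ e E E′ E≈E′ c f =
    cong₂ (λ s t → (if free c e then s else 0) + t) (E≈E′ (c ∪ e) (f ∘ suc)) (E≈E′ c f)

  matchingSum-↭ : ∀ {E E′} → E ↭ E′ → ∀ c f → matchingSum c E f ≡ matchingSum c E′ f
  matchingSum-↭ refl                    c f = refl
  matchingSum-↭ (prep {xs} {ys} e p)      c f = matchingSum-∷ e xs ys (matchingSum-↭ p) c f
  matchingSum-↭ (swap {xs} {ys} x y p)    c f =
    ≡.trans (matchingSum-swap c x y xs f)
      (matchingSum-∷ y (x ∷ xs) (x ∷ ys) (matchingSum-∷ x xs ys (matchingSum-↭ p)) c f)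
  matchingSum-↭ (trans p p′)              c f = ≡.trans (matchingSum-↭ p c f) (matchingSum-↭ p′ c f)

module TilingCounts where

  open import Defs
  open MatchingSums
  open import Data.Nat using (ℕ; zero; suc; _+_; _*_; _∸_; _^_; _≡ᵇ_; _≤_; _<_)
  open import Data.Nat.Properties
  open import Data.Bool using (Bool; true; false; if_then_else_)
  open import Data.Bool.Properties using (∨-identityʳ; ∨-zeroʳ)
  open import Data.Empty using (⊥-elim)
  open import Data.Product using (_,_)
  open import Data.Sum using (inj₁; inj₂)
  open import Data.List using (List; []; _∷_; _++_; applyUpTo)
  open import Data.List.Relation.Binary.Permutation.Propositional using (_↭_)
  open import Function using (_∘_)
  open import Data.Nat.Tactic.RingSolver using (solve-∀)
  open import Relation.Binary.PropositionalEquality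
  open ≡-Reasoning

  ≢⇒≡ᵇ-false : ∀ {m n} → m ≢ n → (m ≡ᵇ n) ≡ false
  ≢⇒≡ᵇ-false {zero}  {zero}  m≢n = ⊥-elim (m≢n refl)
  ≢⇒≡ᵇ-false {zero}  {suc n} m≢n = refl
  ≢⇒≡ᵇ-false {suc m} {zero}  m≢n = refl
  ≢⇒≡ᵇ-false {suc m} {suc n} m≢n = ≢⇒≡ᵇ-false (m≢n ∘ cong suc)

  ≡ᵇ-refl : ∀ n → (n ≡ᵇ n) ≡ true
  ≡ᵇ-refl zero    = refl
  ≡ᵇ-refl (suc n) = ≡ᵇ-refl n

  ∪-miss : ∀ c x y {z} → z ≢ x → z ≢ y → (c ∪ (x , y)) z ≡ c z
  ∪-miss c x y {z} z≢x z≢y rewrite ≢⇒≡ᵇ-false z≢x | ≢⇒≡ᵇ-false z≢y = ∨-identityʳ (c z)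

  ∪-fst : ∀ c x y → (c ∪ (x , y)) x ≡ true
  ∪-fst c x y rewrite ≡ᵇ-refl x = ∨-zeroʳ (c x)

  ∪-snd : ∀ c x y → (c ∪ (x , y)) y ≡ true
  ∪-snd c x y rewrite ≡ᵇ-refl y | ∨-zeroʳ (y ≡ᵇ x) = ∨-zeroʳ (c y)

  path : ℕ → ℕ → List Edge
  path v L = applyUpTo (λ i → v + i , v + suc i) L

  applyUpTo-cong : ∀ {A : Set} {f g : ℕ → A} n → (∀ i → f i ≡ g i) → applyUpTo f n ≡ applyUpTo g n
  applyUpTo-cong zero    f≗g = refl
  applyUpTo-cong (suc n) f≗g = cong₂ _∷_ (f≗g 0) (applyUpTo-cong n (f≗g ∘ suc))

  path-suc : ∀ v L → path v (suc L) ≡ (v , suc v) ∷ path (suc v) L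
  path-suc v L = cong₂ _∷_ (cong₂ _,_ (+-identityʳ v) (+-comm v 1))
    (applyUpTo-cong L λ i → cong₂ _,_ (+-suc v i) (+-suc v (suc i)))

  path-++ : ∀ v L L′ → path v (L + L′) ≡ path v L ++ path (v + L) L′
  path-++ v zero    L′ = cong (λ w → path w L′) (sym (+-identityʳ v))
  path-++ v (suc L) L′ = begin
    path v (suc (L + L′))                            ≡⟨ path-suc v (L + L′) ⟩
    (v , suc v) ∷ path (suc v) (L + L′)              ≡⟨ cong ((v , suc v) ∷_) (path-++ (suc v) L L′) ⟩
    (v , suc v) ∷ (path (suc v) L ++ path (suc v + L) L′)
      ≡⟨ cong₂ (λ p w → p ++ path w L′) (sym (path-suc v L)) (sym (+-suc v L)) ⟩
    path v (suc L) ++ path (v + suc L) L′ ∎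

  oneIfFree : Bool → ℕ
  oneIfFree true  = 0
  oneIfFree false = 1

  module Counting (a b : ℕ) where

    weight : ℕ → ℕ → ℕ
    weight N k = a ^ (N ∸ 2 * k) * b ^ k

    weight-edge : ∀ N k → weight (2 + N) (suc k) ≡ b * weight N k
    weight-edge N k = begin
      a ^ (2 + N ∸ 2 * suc k) * b ^ suc k ≡⟨ cong (λ e → a ^ (2 + N ∸ e) * b ^ suc k) (*-suc 2 k) ⟩
      a ^ (N ∸ 2 * k) * (b * b ^ k)       ≡⟨ reorder (a ^ (N ∸ 2 * k)) b (b ^ k) ⟩
      b * weight N k ∎
      where
      reorder : ∀ x y z → x * (y * z) ≡ y * (x * z)
      reorder = solve-∀

    -- N counts the uncovered squares met by E; the r further squares are met by no edge
    -- of E, hence singles, and quantifying over them is what makes count-single hold.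
    record TilingCount (E : List Edge) (c : Cover) (N w : ℕ) : Set where
      constructor tilingCount
      field count : ∀ r → matchingSum c E (weight (N + r)) ≡ a ^ r * w
    open TilingCount public

    count-[] : ∀ c → TilingCount [] c 0 1
    count-[] c = tilingCount λ r → refl

    count-single : ∀ {E c N w} → TilingCount E c N w → TilingCount E c (suc N) (a * w)
    count-single {E} {c} {N} {w} t = tilingCount λ r → begin
      matchingSum c E (weight (suc N + r)) ≡⟨ cong (matchingSum c E ∘ weight) (sym (+-suc N r)) ⟩
      matchingSum c E (weight (N + suc r)) ≡⟨ count t (suc r) ⟩
      a * a ^ r * w                        ≡⟨ reorder a (a ^ r) w ⟩
      a ^ r * (a * w) ∎
      where
      reorder : ∀ x y z → x * y * z ≡ y * (x * z)
      reorder = solve-∀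

    count-covered : ∀ {E c N w} e → free c e ≡ false → TilingCount E c N w → TilingCount (e ∷ E) c N w
    count-covered {E} {c} {N} e e-covered t = tilingCount λ r →
      trans (cong (λ b → (if b then matchingSum (c ∪ e) E (weight (N + r) ∘ suc) else 0) + matchingSum c E (weight (N + r)))
                  e-covered)
            (count t r)

    count-edge : ∀ {E c N w₁ w₂} e → free c e ≡ true →
                 TilingCount E c (2 + N) w₁ → TilingCount E (c ∪ e) N w₂ →
                 TilingCount (e ∷ E) c (2 + N) (w₁ + b * w₂)
    count-edge {E} {c} {N} {w₁} {w₂} e e-free t₁ t₂ = tilingCount λ r → begin
      (if free c e then matchingSum (c ∪ e) E (weight (2 + N + r) ∘ suc) else 0) + matchingSum c E (weight (2 + N + r))
        ≡⟨ cong₂ _+_ (cong₂ (λ b s → if b then s else 0) e-free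
                        (matchingSum-cong E (λ _ → refl) (weight-edge (N + r))))
                     (count t₁ r) ⟩
      matchingSum (c ∪ e) E (λ k → b * weight (N + r) k) + a ^ r * w₁
        ≡⟨ cong (_+ a ^ r * w₁) (matchingSum-* (c ∪ e) E (weight (N + r)) b) ⟩
      b * matchingSum (c ∪ e) E (weight (N + r)) + a ^ r * w₁
        ≡⟨ cong (λ s → b * s + a ^ r * w₁) (count t₂ r) ⟩
      b * (a ^ r * w₂) + a ^ r * w₁
        ≡⟨ reorder b (a ^ r) w₁ w₂ ⟩
      a ^ r * (w₁ + b * w₂) ∎
      where
      reorder : ∀ b x w₁ w₂ → b * (x * w₂) + x * w₁ ≡ x * (w₁ + b * w₂)
      reorder = solve-∀

    count-≡ : ∀ {E E′ c N w} → E ≡ E′ → TilingCount E c N w → TilingCount E′ c N w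
    count-≡ refl t = t

    count-squares : ∀ {E c N N′ w} → N ≡ N′ → TilingCount E c N w → TilingCount E c N′ w
    count-squares refl t = t

    count-value : ∀ {E c N w w′} → w ≡ w′ → TilingCount E c N w → TilingCount E c N w′
    count-value refl t = t

    count-↭ : ∀ {E E′ c N w} → E ↭ E′ → TilingCount E c N w → TilingCount E′ c N w
    count-↭ {c = c} {N} E↭E′ t = tilingCount λ r → trans (sym (matchingSum-↭ E↭E′ c (weight (N + r)))) (count t r)

    mutual
      pathFromFree : ℕ → ℕ → ℕ → ℕ
      pathFromFree zero    z₀ z₁ = z₀
      pathFromFree (suc L) z₀ z₁ = a * pathFromFree L z₀ z₁ + b * pathFromCovered L z₀ z₁

      pathFromCovered : ℕ → ℕ → ℕ → ℕ
      pathFromCovered zero    z₀ z₁ = z₁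
      pathFromCovered (suc L) z₀ z₁ = pathFromFree L z₀ z₁

    pathFrom : Bool → ℕ → ℕ → ℕ → ℕ
    pathFrom false = pathFromFree
    pathFrom true  = pathFromCovered

    mutual
      pathFromFree-zero : ∀ L → pathFromFree L 0 0 ≡ 0
      pathFromFree-zero zero    = refl
      pathFromFree-zero (suc L) rewrite pathFromFree-zero L | pathFromCovered-zero L | *-zeroʳ a | *-zeroʳ b = refl

      pathFromCovered-zero : ∀ L → pathFromCovered L 0 0 ≡ 0
      pathFromCovered-zero zero    = refl
      pathFromCovered-zero (suc L) = pathFromFree-zero L

    pathFrom-zero : ∀ t L → pathFrom t L 0 0 ≡ 0
    pathFrom-zero false = pathFromFree-zero
    pathFrom-zero true  = pathFromCovered-zero

    -- The path lo, lo + 1, …, ℓ followed by the edges rest: z₀ and z₁ count rest when the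
    -- path leaves ℓ uncovered, resp. covers it; Q is an invariant needed by rest.
    module Path (lo ℓ : ℕ) (Q : Cover → Set)
                (Q-∪ : ∀ c x → lo ≤ x → suc x ≤ ℓ → Q c → Q (c ∪ (x , suc x)))
                (rest : List Edge) (N z₀ z₁ : ℕ)
                (end-free    : ∀ c → Q c → c ℓ ≡ false → TilingCount rest c (suc N) z₀)
                (end-covered : ∀ c → Q c → c ℓ ≡ true  → TilingCount rest c N z₁) where
      mutual
        path-free : ∀ L v → v + L ≡ ℓ → lo ≤ v → ∀ c → Q c → (∀ j → v ≤ j → j ≤ ℓ → c j ≡ false) →
                    TilingCount (path v L ++ rest) c (suc (N + L)) (pathFromFree L z₀ z₁)
        path-free zero    v refl lo≤v c q fr =
          count-squares (cong suc (sym (+-identityʳ N))) (end-free c q (fr (v + 0) (m≤m+n v 0) ≤-refl))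
        path-free (suc L) v v+L≡ℓ lo≤v c q fr =
          count-≡ (cong (_++ rest) (sym (path-suc v L))) (count-squares (cong suc (sym (+-suc N L)))
            (count-edge (v , suc v) (uncovered⇒free c (fr v ≤-refl (<⇒≤ sv≤ℓ)) (fr (suc v) (n≤1+n v) sv≤ℓ))
              (count-single (path-free L (suc v) sv+L≡ℓ lo≤sv c q (λ j sv≤j → fr j (<⇒≤ sv≤j))))
              (path-covered L (suc v) sv+L≡ℓ lo≤sv (c ∪ (v , suc v))
                 (Q-∪ c v lo≤v sv≤ℓ q) (∪-snd c v (suc v))
                 (λ j sv<j j≤ℓ → trans (∪-miss c v (suc v) (>⇒≢ (<-trans (n<1+n v) sv<j)) (>⇒≢ sv<j))
                                       (fr j (<⇒≤ (<-trans (n<1+n v) sv<j)) j≤ℓ)))))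
          where
          sv+L≡ℓ : suc v + L ≡ ℓ
          sv+L≡ℓ = trans (sym (+-suc v L)) v+L≡ℓ
          lo≤sv : lo ≤ suc v
          lo≤sv = ≤-trans lo≤v (n≤1+n v)
          sv≤ℓ : suc v ≤ ℓ
          sv≤ℓ = subst (suc v ≤_) sv+L≡ℓ (m≤m+n (suc v) L)

        path-covered : ∀ L v → v + L ≡ ℓ → lo ≤ v → ∀ c → Q c → c v ≡ true →
                       (∀ j → v < j → j ≤ ℓ → c j ≡ false) →
                       TilingCount (path v L ++ rest) c (N + L) (pathFromCovered L z₀ z₁)
        path-covered zero    v v+0≡ℓ lo≤v c q c[v] fr =
          count-squares (sym (+-identityʳ N))
            (end-covered c q (subst (λ j → c j ≡ true) (trans (sym (+-identityʳ v)) v+0≡ℓ) c[v]))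
        path-covered (suc L) v v+L≡ℓ lo≤v c q c[v] fr =
          count-≡ (cong (_++ rest) (sym (path-suc v L))) (count-squares (sym (+-suc N L))
            (count-covered (v , suc v) (covered₁⇒¬free c c[v])
              (path-free L (suc v) (trans (sym (+-suc v L)) v+L≡ℓ) (≤-trans lo≤v (n≤1+n v)) c q fr)))

      path-count : ∀ t L c → lo + L ≡ ℓ → Q c → c lo ≡ t → (∀ j → lo < j → j ≤ ℓ → c j ≡ false) →
                   TilingCount (path lo L ++ rest) c (oneIfFree t + (N + L)) (pathFrom t L z₀ z₁)
      path-count false L c lo+L≡ℓ q c[lo] ahead = path-free L lo lo+L≡ℓ ≤-refl c q fr
        where
        fr : ∀ j → lo ≤ j → j ≤ ℓ → c j ≡ false
        fr j lo≤j j≤ℓ with m≤n⇒m<n∨m≡n lo≤j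
        ... | inj₁ lo<j  = ahead j lo<j j≤ℓ
        ... | inj₂ refl  = c[lo]
      path-count true  L c lo+L≡ℓ q c[lo] ahead = path-covered L lo lo+L≡ℓ ≤-refl c q c[lo] ahead

module Columns where

  open import Defs
  open MatchingSums
  open TilingCounts
  open import Data.Nat using (ℕ; zero; suc; _+_; _*_; _∸_; _≤_; _<_; z≤n; s≤s)
  open import Data.Nat.Properties
  open import Data.Bool using (Bool; true; false; _∧_)
  open import Data.Product using (_×_; _,_)
  open import Data.Sum using (_⊎_; inj₁; inj₂)
  open import Data.Unit using (⊤; tt)
  open import Data.List using (List; []; _∷_; _++_; applyUpTo; length)
  open import Data.List.Properties using (++-assoc; map-upTo)
  open import Function using (_∘_)
  open import Data.Nat.Tactic.RingSolver using (solve-∀)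
  open import Data.List.Relation.Binary.Permutation.Propositional
    using (_↭_; prep; ↭-sym; ↭-trans; ↭-reflexive)
  open import Data.List.Relation.Binary.Permutation.Propositional.Properties using (shift; shifts; ++⁺ˡ)
  open import Relation.Binary.PropositionalEquality
  open ≡-Reasoning

  ↭-column : ∀ (top rung bridge : Edge) (T B B′ R : List Edge) →
             rung ∷ top ∷ (B ++ bridge ∷ (T ++ B′ ++ R)) ↭ (top ∷ T) ++ (B ++ bridge ∷ B′) ++ (rung ∷ R)
  ↭-column top rung bridge T B B′ R = ↭-sym (↭-trans rung-to-front (prep rung (prep top bottom-to-front)))
    where
    Y = B ++ bridge ∷ B′
    rung-to-front : (top ∷ T) ++ Y ++ (rung ∷ R) ↭ rung ∷ top ∷ ((T ++ Y) ++ R)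
    rung-to-front = ↭-trans (↭-reflexive (sym (++-assoc (top ∷ T) Y (rung ∷ R)))) (shift rung ((top ∷ T) ++ Y) R)
    bottom-to-front : (T ++ Y) ++ R ↭ B ++ bridge ∷ (T ++ B′ ++ R)
    bottom-to-front =
      ↭-trans (↭-reflexive (++-assoc T Y R))
      (↭-trans (shifts T Y)
      (↭-trans (↭-reflexive (++-assoc B (bridge ∷ B′) (T ++ R)))
               (++⁺ˡ B (prep bridge (shifts B′ T)))))

  -- Column i of the board consists of the first-level square i and the m = q - 3
  -- second-level squares n + i m, …, n + i m + m - 1 around A_{i+1}.
  module Transfer (a b m′ : ℕ) where
    open Counting a b

    m : ℕ
    m = suc m′

    rungs : ℕ → ℕ → ℕ → List Edge
    rungs c v k = applyUpTo (λ i → c + i , v + i * m) k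

    -- the last k columns, starting with first-level square c and second-level square v
    columns : ℕ → ℕ → ℕ → List Edge
    columns c v k = path c (k ∸ 1) ++ path v (k * m ∸ 1) ++ rungs c v k

    rungs-suc : ∀ c v k → rungs c v (suc k) ≡ (c , v) ∷ rungs (suc c) (v + m) k
    rungs-suc c v k = cong₂ _∷_ (cong₂ _,_ (+-identityʳ c) (+-identityʳ v))
      (applyUpTo-cong k λ i → cong₂ _,_ (+-suc c i) (sym (+-assoc v m (i * m))))

    columns-suc : ∀ c v k →
      columns c v (suc (suc k)) ≡ ((c , suc c) ∷ path (suc c) k)
                                ++ (path v m′ ++ (v + m′ , v + m) ∷ path (v + m) (m′ + k * m))
                                ++ ((c , v) ∷ rungs (suc c) (v + m) (suc k))
    columns-suc c v k = cong₂ _++_ (path-suc c k) (cong₂ _++_ bottom (rungs-suc c v (suc k)))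
      where
      bottom : path v (m′ + (m + k * m)) ≡ path v m′ ++ (v + m′ , v + m) ∷ path (v + m) (m′ + k * m)
      bottom = trans (path-++ v m′ (m + k * m)) (cong (path v m′ ++_) (trans (path-suc (v + m′) (m′ + k * m))
                 (cong (λ w → (v + m′ , w) ∷ path w (m′ + k * m)) (sym (+-suc v m′)))))

    -- counts of the remaining columns, indexed by the covering flags of their first
    -- first-level square and their first second-level square
    Weights : Set
    Weights = Bool → Bool → ℕ

    -- count of the second-level squares of a column whose first one has flag t, when
    -- the next column's first-level square gets flag s′
    block : Weights → Bool → Bool → ℕ
    block w t s′ = pathFrom t m′ (a * w s′ false + b * w s′ true) (w s′ false)

    column : Weights → Weights
    column w true  t     = block w t false
    column w false true  = a * block w true false + b * block w true true
    column w false false = (a * block w false false + b * block w false true) + b * block w true false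

    -- W 0 counts an empty remainder: 1 if no domino enters it, else 0
    W : ℕ → Weights
    W zero    false false = 1
    W zero    false true  = 0
    W zero    true  _     = 0
    W (suc k) = column (W k)

    -- number of squares of the last k + 1 columns other than their two first squares
    inner : ℕ → ℕ
    inner zero    = m′
    inner (suc k) = suc (suc (inner k + m′))

    uncovered : ℕ → Bool → Bool → ℕ
    uncovered k s t = oneIfFree t + (oneIfFree s + inner k)


  module Board (a b m′ n : ℕ) where
    open Counting a b
    open Transfer a b m′

    -- Frontier c v s t cv: in the last columns, starting at squares c and v, only c and v
    -- may already be covered (by a domino of the previous column), as recorded by s and t.
    record Frontier (c v : ℕ) (s t : Bool) (cv : Cover) : Set where
      field
        top-state    : cv c ≡ s
        bottom-state : cv v ≡ t
        top-ahead    : ∀ j → c < j → j < n → cv j ≡ false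
        bottom-ahead : ∀ j → v < j → cv j ≡ false
    open Frontier

    Behind : ℕ → ℕ → ℕ → Set
    Behind c v x = x < c ⊎ (n ≤ x × x < v)

    behind⇒≢ : ∀ {c v x z} → c < n → Behind c v x → c ≤ z → z < n ⊎ v ≤ z → z ≢ x
    behind⇒≢ c<n (inj₁ x<c)        c≤z _          = >⇒≢ (<-≤-trans x<c c≤z)
    behind⇒≢ c<n (inj₂ (n≤x , x<v)) c≤z (inj₁ z<n) = <⇒≢ (<-≤-trans z<n n≤x)
    behind⇒≢ c<n (inj₂ (n≤x , x<v)) c≤z (inj₂ v≤z) = >⇒≢ (<-≤-trans x<v v≤z)

    frontier-∪ : ∀ {c v s t cv x y} → c < n → n ≤ v → Behind c v x → Behind c v y →
                 Frontier c v s t cv → Frontier c v s t (cv ∪ (x , y))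
    frontier-∪ {c} {v} {cv = cv} {x} {y} c<n n≤v bx by f = record
      { top-state    = miss ≤-refl (inj₁ c<n) (top-state f)
      ; bottom-state = miss c≤v (inj₂ ≤-refl) (bottom-state f)
      ; top-ahead    = λ j c<j j<n → miss (<⇒≤ c<j) (inj₁ j<n) (top-ahead f j c<j j<n)
      ; bottom-ahead = λ j v<j → miss (≤-trans c≤v (<⇒≤ v<j)) (inj₂ (<⇒≤ v<j)) (bottom-ahead f j v<j)
      }
      where
      c≤v : c ≤ v
      c≤v = <⇒≤ (<-≤-trans c<n n≤v)
      miss : ∀ {z w} → c ≤ z → z < n ⊎ v ≤ z → cv z ≡ w → (cv ∪ (x , y)) z ≡ w
      miss c≤z ahead eq = trans (∪-miss cv x y (behind⇒≢ c<n bx c≤z ahead) (behind⇒≢ c<n by c≤z ahead)) eq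

    frontier-top : ∀ {c v t cv} → suc c < n → n ≤ v →
                   Frontier (suc c) v false t cv → Frontier (suc c) v true t (cv ∪ (c , suc c))
    frontier-top {c} {v} {cv = cv} sc<n n≤v f = record
      { top-state    = ∪-snd cv c (suc c)
      ; bottom-state = miss sc<v (bottom-state f)
      ; top-ahead    = λ j sc<j j<n → miss sc<j (top-ahead f j sc<j j<n)
      ; bottom-ahead = λ j v<j → miss (<-trans sc<v v<j) (bottom-ahead f j v<j)
      }
      where
      sc<v : suc c < v
      sc<v = <-≤-trans sc<n n≤v
      miss : ∀ {z w} → suc c < z → cv z ≡ w → (cv ∪ (c , suc c)) z ≡ w
      miss sc<z = trans (∪-miss cv c (suc c) (>⇒≢ (<-trans (n<1+n c) sc<z)) (>⇒≢ sc<z))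

    frontier-bridge : ∀ {c v s cv x} → c < n → n ≤ x → x < v →
                      Frontier c v s false cv → Frontier c v s true (cv ∪ (x , v))
    frontier-bridge {c} {v} {cv = cv} {x} c<n n≤x x<v f = record
      { top-state    = miss (<-≤-trans c<n n≤x) (top-state f)
      ; bottom-state = ∪-snd cv x v
      ; top-ahead    = λ j c<j j<n → miss (<-≤-trans j<n n≤x) (top-ahead f j c<j j<n)
      ; bottom-ahead = λ j v<j → trans (∪-miss cv x v (>⇒≢ (<-trans x<v v<j)) (>⇒≢ v<j)) (bottom-ahead f j v<j)
      }
      where
      miss : ∀ {z w} → z < x → cv z ≡ w → (cv ∪ (x , v)) z ≡ w
      miss z<x = trans (∪-miss cv x v (<⇒≢ z<x) (<⇒≢ (<-trans z<x x<v)))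

    frontier-next : ∀ {c v s t cv} → suc c < n → Frontier c v s t cv → Frontier (suc c) (v + m) false false cv
    frontier-next {c} {v} sc<n f = record
      { top-state    = top-ahead f (suc c) (n<1+n c) sc<n
      ; bottom-state = bottom-ahead f (v + m) v<v+m
      ; top-ahead    = λ j sc<j j<n → top-ahead f j (<-trans (n<1+n c) sc<j) j<n
      ; bottom-ahead = λ j v+m<j → bottom-ahead f j (<-trans v<v+m v+m<j)
      }
      where
      v<v+m : v < v + m
      v<v+m = m<m+n v (s≤s z≤n)

    ∪-ahead : ∀ {v} cv x y → x ≤ v → y ≤ v → (∀ j → v < j → cv j ≡ false) →
              ∀ j → v < j → (cv ∪ (x , y)) j ≡ false
    ∪-ahead cv x y x≤v y≤v ahead j v<j =
      trans (∪-miss cv x y (>⇒≢ (≤-<-trans x≤v v<j)) (>⇒≢ (≤-<-trans y≤v v<j))) (ahead j v<j)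

    module Column (k c v : ℕ) (sc<n : suc c < n) (n≤v : n ≤ v)
                  (next : ∀ s t cv → Frontier (suc c) (v + m) s t cv →
                          TilingCount (columns (suc c) (v + m) (suc k)) cv (uncovered k s t) (W (suc k) s t))
                  where

      rung top bridge : Edge
      rung   = (c , v)
      top    = (c , suc c)
      bridge = (v + m′ , v + m)

      rest : List Edge
      rest = bridge ∷ columns (suc c) (v + m) (suc k)

      v+m′<v+m : v + m′ < v + m
      v+m′<v+m = +-monoʳ-< v (n<1+n m′)

      n≤v+m′ : n ≤ v + m′
      n≤v+m′ = ≤-trans n≤v (m≤m+n v m′)

      n≤v+m : n ≤ v + m
      n≤v+m = ≤-trans n≤v (m≤m+n v m)

      sc<v : suc c < v
      sc<v = <-≤-trans sc<n n≤v

      c<v : c < v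
      c<v = <-trans (n<1+n c) sc<v

      end-free : ∀ s′ cv → Frontier (suc c) (v + m) s′ false cv → cv (v + m′) ≡ false →
                 TilingCount rest cv (suc (uncovered k s′ false)) (a * W (suc k) s′ false + b * W (suc k) s′ true)
      end-free s′ cv f cv[v+m′] =
        count-edge bridge (uncovered⇒free cv cv[v+m′] (bottom-state f)) (count-single (next s′ false cv f))
          (next s′ true (cv ∪ bridge) (frontier-bridge sc<n n≤v+m′ v+m′<v+m f))

      end-covered : ∀ s′ cv → Frontier (suc c) (v + m) s′ false cv → cv (v + m′) ≡ true →
                    TilingCount rest cv (uncovered k s′ false) (W (suc k) s′ false)
      end-covered s′ cv f cv[v+m′] = count-covered bridge (covered₁⇒¬free cv cv[v+m′]) (next s′ false cv f)

      behind : ∀ {x} → v ≤ x → x < v + m → Behind (suc c) (v + m) x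
      behind v≤x x<v+m = inj₂ (≤-trans n≤v v≤x , x<v+m)

      module BottomPath (s′ : Bool) =
        Path v (v + m′) (Frontier (suc c) (v + m) s′ false)
          (λ cv x v≤x sx≤v+m′ → frontier-∪ sc<n n≤v+m
             (behind v≤x (<-≤-trans sx≤v+m′ (<⇒≤ v+m′<v+m)))
             (behind (≤-trans v≤x (n≤1+n x)) (≤-<-trans sx≤v+m′ v+m′<v+m)))
          rest (uncovered k s′ false) _ _ (end-free s′) (end-covered s′)

      bottom : ∀ t s′ cv → Frontier (suc c) (v + m) s′ false cv → cv v ≡ t → (∀ j → v < j → cv j ≡ false) →
               TilingCount (path v m′ ++ rest) cv (oneIfFree t + (uncovered k s′ false + m′)) (block (W (suc k)) t s′)
      bottom t s′ cv f cv[v] ahead = BottomPath.path-count s′ t m′ cv refl f cv[v] (λ j v<j _ → ahead j v<j)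

      bottom-without-top : ∀ {s} t cv → Frontier c v s t cv →
        TilingCount (path v m′ ++ rest) cv (oneIfFree t + (uncovered k false false + m′)) (block (W (suc k)) t false)
      bottom-without-top t cv f = bottom t false cv (frontier-next sc<n f) (bottom-state f) (bottom-ahead f)

      bottom-with-top : ∀ t cv → Frontier c v false t cv →
        TilingCount (path v m′ ++ rest) (cv ∪ top) (oneIfFree t + (uncovered k true false + m′)) (block (W (suc k)) t true)
      bottom-with-top t cv f =
        bottom t true (cv ∪ top) (frontier-top sc<n n≤v+m (frontier-next sc<n f))
          (trans (∪-miss cv c (suc c) (>⇒≢ c<v) (>⇒≢ sc<v)) (bottom-state f))
          (∪-ahead cv c (suc c) (<⇒≤ c<v) (<⇒≤ sc<v) (bottom-ahead f))

      bottom-with-rung : ∀ cv → Frontier c v false false cv →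
        TilingCount (path v m′ ++ rest) (cv ∪ rung) (uncovered k false false + m′) (block (W (suc k)) true false)
      bottom-with-rung cv f =
        bottom true false (cv ∪ rung)
          (frontier-∪ sc<n n≤v+m (inj₁ (n<1+n c)) (behind ≤-refl (m<m+n v (s≤s z≤n))) (frontier-next sc<n f))
          (∪-snd cv c v) (∪-ahead cv c v (<⇒≤ c<v) ≤-refl (bottom-ahead f))

      top-free : ∀ {t} cv → Frontier c v false t cv → free cv top ≡ true
      top-free cv f = uncovered⇒free cv (top-state f) (top-ahead f (suc c) (n<1+n c) sc<n)

      column-count : ∀ s t cv → Frontier c v s t cv →
                     TilingCount (rung ∷ top ∷ path v m′ ++ rest) cv (uncovered (suc k) s t) (column (W (suc k)) s t)
      column-count true  t     cv f =
        count-covered rung (covered₁⇒¬free cv (top-state f))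
          (count-covered top (covered₁⇒¬free cv (top-state f)) (bottom-without-top t cv f))
      column-count false true  cv f =
        count-covered rung (covered₂⇒¬free cv (bottom-state f))
          (count-edge top (top-free cv f) (count-single (bottom-without-top true cv f)) (bottom-with-top true cv f))
      column-count false false cv f =
        count-edge rung (uncovered⇒free cv (top-state f) (bottom-state f))
          (count-edge top (top-free cv f) (count-single (bottom-without-top false cv f)) (bottom-with-top false cv f))
          (count-covered top (covered₁⇒¬free (cv ∪ rung) (∪-fst cv c v)) (bottom-with-rung cv f))

    module LastColumn (c v : ℕ) (c<n : c < n) (n≤v : n ≤ v) where

      module BottomPath =
        Path v (v + m′) (λ _ → ⊤) (λ _ _ _ _ _ → tt) [] 0 (a * 1) 1
          (λ cv _ _ → count-single (count-[] cv)) (λ cv _ _ → count-[] cv)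

      bottom : ∀ t cv → cv v ≡ t → (∀ j → v < j → cv j ≡ false) →
               TilingCount (path v m′ ++ []) cv (oneIfFree t + m′) (pathFrom t m′ (a * 1) 1)
      bottom t cv cv[v] ahead = BottomPath.path-count t m′ cv refl tt cv[v] (λ j v<j _ → ahead j v<j)

      block-W₀-false : ∀ t → block (W 0) t false ≡ pathFrom t m′ (a * 1) 1
      block-W₀-false t = cong (λ z → pathFrom t m′ z 1) (trans (cong (a * 1 +_) (*-zeroʳ b)) (+-identityʳ (a * 1)))

      block-W₀-true : ∀ t → block (W 0) t true ≡ 0
      block-W₀-true t = trans (cong (λ z → pathFrom t m′ z 0) (cong₂ _+_ (*-zeroʳ a) (*-zeroʳ b)))
                              (pathFrom-zero t m′)

      last-count : ∀ s t cv → Frontier c v s t cv →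
                   TilingCount ((c , v) ∷ path v m′ ++ []) cv (uncovered 0 s t) (column (W 0) s t)
      last-count true t cv f =
        count-covered (c , v) (covered₁⇒¬free cv (top-state f))
          (count-value (sym (block-W₀-false t)) (bottom t cv (bottom-state f) (bottom-ahead f)))
      last-count false true cv f =
        count-covered (c , v) (covered₂⇒¬free cv (bottom-state f))
          (count-value value (count-single (bottom true cv (bottom-state f) (bottom-ahead f))))
        where
        value : a * pathFrom true m′ (a * 1) 1 ≡ a * block (W 0) true false + b * block (W 0) true true
        value rewrite block-W₀-false true | block-W₀-true true | *-zeroʳ b = sym (+-identityʳ _)
      last-count false false cv f =
        count-value value (count-edge (c , v) (uncovered⇒free cv (top-state f) (bottom-state f))
          (count-single (bottom false cv (bottom-state f) (bottom-ahead f)))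
          (bottom true (cv ∪ (c , v)) (∪-snd cv c v) (∪-ahead cv c v (<⇒≤ (<-≤-trans c<n n≤v)) ≤-refl (bottom-ahead f))))
        where
        value : a * pathFrom false m′ (a * 1) 1 + b * pathFrom true m′ (a * 1) 1
              ≡ (a * block (W 0) false false + b * block (W 0) false true) + b * block (W 0) true false
        value rewrite block-W₀-false false | block-W₀-true false | block-W₀-false true | *-zeroʳ b
                    | +-identityʳ (a * pathFrom false m′ (a * 1) 1) = refl

    columns-count : ∀ k c v → c + suc k ≤ n → n ≤ v → ∀ s t cv → Frontier c v s t cv →
                    TilingCount (columns c v (suc k)) cv (uncovered k s t) (W (suc k) s t)
    columns-count zero c v c+1≤n n≤v s t cv f =
      count-↭ (↭-sym (↭-trans (↭-reflexive edges) (shift (c , v) (path v m′) [])))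
        (LastColumn.last-count c v (subst (_≤ n) (+-comm c 1) c+1≤n) n≤v s t cv f)
      where
      edges : columns c v 1 ≡ path v m′ ++ (c , v) ∷ []
      edges = cong₂ (λ L e → path v L ++ e ∷ []) (+-identityʳ m′) (cong₂ _,_ (+-identityʳ c) (+-identityʳ v))
    columns-count (suc k) c v c+2+k≤n n≤v s t cv f =
      count-↭ (↭-trans (↭-column (c , suc c) (c , v) (v + m′ , v + m) (path (suc c) k) (path v m′)
                                  (path (v + m) (m′ + k * m)) (rungs (suc c) (v + m) (suc k)))
                       (↭-reflexive (sym (columns-suc c v k))))
        (Column.column-count k c v sc<n n≤v (columns-count k (suc c) (v + m) sc+1+k≤n (≤-trans n≤v (m≤m+n v m))) s t cv f)
      where
      sc+1+k≤n : suc c + suc k ≤ n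
      sc+1+k≤n = subst (_≤ n) (+-suc c (suc k)) c+2+k≤n
      sc<n : suc c < n
      sc<n = ≤-trans (s≤s (s≤s (m≤m+n c k))) (subst (_≤ n) (trans (+-suc c (suc k)) (cong suc (+-suc c k))) c+2+k≤n)

  module _ (a b m′ k : ℕ) where
    open Counting a b
    open Transfer a b m′
    open Board a b m′ (suc k)

    private
      q n : ℕ
      q = 4 + m′
      n = suc k

    ∅ : Cover
    ∅ _ = false

    allᵇ-free-∅ : ∀ M → allᵇ (free ∅) M ≡ true
    allᵇ-free-∅ []      = refl
    allᵇ-free-∅ (e ∷ M) = allᵇ-free-∅ M

    boardEdges≡columns : boardEdges q n ≡ columns 0 n n
    boardEdges≡columns = cong₂ _++_ (map-upTo _ (n ∸ 1)) (cong₂ _++_ (map-upTo _ (n * m ∸ 1)) (map-upTo _ n))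

    inner≡ : ∀ j → suc (suc (inner j)) ≡ suc j + suc j * m
    inner≡ zero    = cong (suc ∘ suc) (sym (+-identityʳ m′))
    inner≡ (suc j) = begin
      suc (suc (suc (suc (inner j + m′))))   ≡⟨ cong (λ x → suc (suc (x + m′))) (inner≡ j) ⟩
      suc (suc (suc j + suc j * m + m′))     ≡⟨ rearrange j m′ ⟩
      suc (suc j) + suc (suc j) * m ∎
      where
      rearrange : ∀ j m′ → suc (suc (suc j + suc j * suc m′ + m′)) ≡ suc (suc j) + suc (suc j) * suc m′
      rearrange = solve-∀

    R≡W : R a b q n ≡ W n false false
    R≡W = begin
      R a b q n
        ≡⟨ sum-map-filterᵇ isMatchingᵇ _ (sublists (boardEdges q n)) ⟩
      sumWhere isMatchingᵇ (weight (boardSize q n) ∘ length) (sublists (boardEdges q n))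
        ≡⟨ sumWhere-cong (sublists (boardEdges q n)) (λ M → cong (_∧ isMatchingᵇ M) (sym (allᵇ-free-∅ M))) ⟩
      sumWhere (avoids ∅) (weight (boardSize q n) ∘ length) (sublists (boardEdges q n))
        ≡⟨ sumWhere-sublists ∅ (boardEdges q n) (weight (boardSize q n)) ⟩
      matchingSum ∅ (boardEdges q n) (weight (boardSize q n))
        ≡⟨ cong₂ (λ E N → matchingSum ∅ E (weight N)) boardEdges≡columns (trans (sym (inner≡ k)) (sym (+-identityʳ _))) ⟩
      matchingSum ∅ (columns 0 n n) (weight (uncovered k false false + 0))
        ≡⟨ count (columns-count k 0 n ≤-refl ≤-refl false false ∅ frontier-∅) 0 ⟩
      1 * W n false false
        ≡⟨ *-identityˡ _ ⟩
      W n false false ∎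
      where
      frontier-∅ : Frontier 0 n false false ∅
      frontier-∅ = record { top-state = refl ; bottom-state = refl
                          ; top-ahead = λ _ _ _ → refl ; bottom-ahead = λ _ _ → refl }

module MatrixRecurrences where

  open import Data.Nat as ℕ using (ℕ; zero; suc)
  open import Data.Integer using (ℤ; +_; _+_; _*_; -_; _-_)
  open import Data.Integer.Tactic.RingSolver using (solve-∀)
  open import Data.Product using (_×_; _,_)
  open import Relation.Binary.PropositionalEquality

  record Matrix₂ : Set where
    constructor matrix
    field e₀₀ e₀₁ e₁₀ e₁₁ : ℤ
  open Matrix₂ public

  trace det : Matrix₂ → ℤ
  trace X = e₀₀ X + e₁₁ X
  det   X = e₀₀ X * e₁₁ X - e₀₁ X * e₁₀ X

  -- the bilinear form with det (X + H) = det X + mixedDet X H + det H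
  mixedDet : Matrix₂ → Matrix₂ → ℤ
  mixedDet X H = e₀₀ X * e₁₁ H + e₁₁ X * e₀₀ H - e₀₁ X * e₁₀ H - e₁₀ X * e₀₁ H

  -- If z = (p, q) satisfies z (k + 2) = X z (k + 1) + H z k, then det (λ² - λ X - H) = 0 gives a
  -- fourth order recurrence for p alone.
  cayley-hamilton₂ : ∀ (X H : Matrix₂) (p q : ℕ → ℤ) →
    (∀ k → p (2 ℕ.+ k) ≡ e₀₀ X * p (1 ℕ.+ k) + e₀₁ X * q (1 ℕ.+ k) + e₀₀ H * p k + e₀₁ H * q k) →
    (∀ k → q (2 ℕ.+ k) ≡ e₁₀ X * p (1 ℕ.+ k) + e₁₁ X * q (1 ℕ.+ k) + e₁₀ H * p k + e₁₁ H * q k) →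
    ∀ k → p (4 ℕ.+ k) ≡ trace X * p (3 ℕ.+ k) + (trace H - det X) * p (2 ℕ.+ k)
                      + (- mixedDet X H) * p (1 ℕ.+ k) - det H * p k
  cayley-hamilton₂ (matrix x₀₀ x₀₁ x₁₀ x₁₁) (matrix h₀₀ h₀₁ h₁₀ h₁₁) p q p-rec q-rec k =
    eliminate (p k) (q k) (p (1 ℕ.+ k)) (q (1 ℕ.+ k)) (p (2 ℕ.+ k)) (q (2 ℕ.+ k)) (p (3 ℕ.+ k)) (q (3 ℕ.+ k)) (p (4 ℕ.+ k))
      (p-rec k) (q-rec k) (p-rec (1 ℕ.+ k)) (q-rec (1 ℕ.+ k)) (p-rec (2 ℕ.+ k))
    where
    step₀ step₁ : ℤ → ℤ → ℤ → ℤ → ℤ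
    step₀ p₁ q₁ p₀ q₀ = x₀₀ * p₁ + x₀₁ * q₁ + h₀₀ * p₀ + h₀₁ * q₀
    step₁ p₁ q₁ p₀ q₀ = x₁₀ * p₁ + x₁₁ * q₁ + h₁₀ * p₀ + h₁₁ * q₀
    identity : ∀ x₀₀ x₀₁ x₁₀ x₁₁ h₀₀ h₀₁ h₁₀ h₁₁ p₀ q₀ p₁ q₁ →
      let p₂ = x₀₀ * p₁ + x₀₁ * q₁ + h₀₀ * p₀ + h₀₁ * q₀
          q₂ = x₁₀ * p₁ + x₁₁ * q₁ + h₁₀ * p₀ + h₁₁ * q₀
          p₃ = x₀₀ * p₂ + x₀₁ * q₂ + h₀₀ * p₁ + h₀₁ * q₁
          q₃ = x₁₀ * p₂ + x₁₁ * q₂ + h₁₀ * p₁ + h₁₁ * q₁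
      in x₀₀ * p₃ + x₀₁ * q₃ + h₀₀ * p₂ + h₀₁ * q₂
         ≡ (x₀₀ + x₁₁) * p₃ + ((h₀₀ + h₁₁) - (x₀₀ * x₁₁ - x₀₁ * x₁₀)) * p₂
           + (- (x₀₀ * h₁₁ + x₁₁ * h₀₀ - x₀₁ * h₁₀ - x₁₀ * h₀₁)) * p₁ - (h₀₀ * h₁₁ - h₀₁ * h₁₀) * p₀
    identity = solve-∀
    eliminate : ∀ p₀ q₀ p₁ q₁ p₂ q₂ p₃ q₃ p₄ →
      p₂ ≡ step₀ p₁ q₁ p₀ q₀ → q₂ ≡ step₁ p₁ q₁ p₀ q₀ →
      p₃ ≡ step₀ p₂ q₂ p₁ q₁ → q₃ ≡ step₁ p₂ q₂ p₁ q₁ → p₄ ≡ step₀ p₃ q₃ p₂ q₂ →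
      p₄ ≡ (x₀₀ + x₁₁) * p₃ + ((h₀₀ + h₁₁) - (x₀₀ * x₁₁ - x₀₁ * x₁₀)) * p₂
           + (- (x₀₀ * h₁₁ + x₁₁ * h₀₀ - x₀₁ * h₁₀ - x₁₀ * h₀₁)) * p₁ - (h₀₀ * h₁₁ - h₀₁ * h₁₀) * p₀
    eliminate p₀ q₀ p₁ q₁ _ _ _ _ _ refl refl refl refl refl =
      identity x₀₀ x₀₁ x₁₀ x₁₁ h₀₀ h₀₁ h₁₀ h₁₁ p₀ q₀ p₁ q₁

  orbit : Matrix₂ → Matrix₂ → ℕ → ℤ × ℤ
  orbit X H zero          = + 1 , + 0
  orbit X H (suc zero)    = e₀₀ X , e₁₀ X
  orbit X H (suc (suc k)) =
    let (p₁ , q₁) = orbit X H (suc k)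
        (p₀ , q₀) = orbit X H k
    in e₀₀ X * p₁ + e₀₁ X * q₁ + e₀₀ H * p₀ + e₀₁ H * q₀ ,
       e₁₀ X * p₁ + e₁₁ X * q₁ + e₁₀ H * p₀ + e₁₁ H * q₀

module IntegerCounts where

  open import Defs
  open TilingCounts using (module Counting)
  open Columns using (module Transfer; R≡W)
  open MatrixRecurrences
  open import Data.Nat as ℕ using (ℕ; zero; suc)
  open import Data.Bool using (Bool; true; false)
  open import Data.Integer using (ℤ; +_; _+_; _*_; -_; _-_; _^_)
  open import Data.Integer.Properties using (pos-+; pos-*)
  open import Data.Nat.Properties using (+-suc; +-comm)
  open import Data.Integer.Tactic.RingSolver using (solve-∀; solve)
  open import Data.List using (_∷_; [])
  open import Data.Product using (_×_; _,_; proj₁; proj₂)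
  open import Relation.Binary.PropositionalEquality
  open ≡-Reasoning

  -- Below x and y stand for u k and u (k - 1). The identities are fields of a record since
  -- the ring solver does not unfold top-level definitions, but sees those of the record
  -- inlined in its field types.
  record TransferIdentities (A B : ℤ) : Set where
    next : ℤ → ℤ → ℤ
    next x y = A * x + B * y

    x₀₀ : ℤ → ℤ → ℤ
    x₀₀ x y = A * next x y + B * x
    x₀₁ : ℤ → ℤ → ℤ
    x₀₁ x y = B * next x y
    x₁₀ : ℤ → ℤ → ℤ
    x₁₀ x y = A * x
    x₁₁ : ℤ → ℤ → ℤ
    x₁₁ x y = A * B * y
    h₀₀ : ℤ → ℤ → ℤ
    h₀₀ x y = B * (next x y * next x y + B * x * x)
    h₀₁ : ℤ → ℤ → ℤ
    h₀₁ x y = B * B * x * (next x y + B * y)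
    h₁₀ : ℤ → ℤ → ℤ
    h₁₀ x y = B * x * (next x y + B * y)
    h₁₁ : ℤ → ℤ → ℤ
    h₁₁ x y = B * B * (x * x + B * y * y)

    transferX : ℤ → ℤ → Matrix₂
    transferX x y = matrix (x₀₀ x y) (x₀₁ x y) (x₁₀ x y) (x₁₁ x y)
    transferH : ℤ → ℤ → Matrix₂
    transferH x y = matrix (h₀₀ x y) (h₀₁ x y) (h₁₀ x y) (h₁₁ x y)

    α-poly : ℤ → ℤ → ℤ
    α-poly x y = x₀₀ x y + x₁₁ x y
    β-poly : ℤ → ℤ → ℤ
    β-poly x y = (h₀₀ x y + h₁₁ x y) - (x₀₀ x y * x₁₁ x y - x₀₁ x y * x₁₀ x y)
    γ-poly : ℤ → ℤ → ℤ
    γ-poly x y = - (x₀₀ x y * h₁₁ x y + x₁₁ x y * h₀₀ x y - x₀₁ x y * h₁₀ x y - x₁₀ x y * h₀₁ x y)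
    δ-poly : ℤ → ℤ → ℤ
    δ-poly x y = h₀₀ x y * h₁₁ x y - h₀₁ x y * h₁₀ x y
    cassini : ℤ → ℤ → ℤ
    cassini x y = x * x - A * x * y - B * y * y

    -- the second-level squares of a column, the first one free or covered, followed by
    -- columns counted by p and q (their first second-level square free, resp. covered)
    blockFree : ℤ → ℤ → ℤ → ℤ → ℤ
    blockFree x y p q = x * (A * p + B * q) + B * y * p
    blockCovered : ℤ → ℤ → ℤ → ℤ → ℤ
    blockCovered x y p q = y * (A * p + B * q) + (x - A * y) * p

    columnFF : ℤ → ℤ → ℤ → ℤ → ℤ → ℤ → ℤ
    columnFF x y p q r s = (A * blockFree x y p q + B * blockFree x y r s) + B * blockCovered x y p q
    columnFT : ℤ → ℤ → ℤ → ℤ → ℤ → ℤ → ℤ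
    columnFT x y p q r s = A * blockCovered x y p q + B * blockCovered x y r s

    field
      two-step₀ : ∀ x y p₀ q₀ p₁ q₁ → columnFF x y p₁ q₁ (blockFree x y p₀ q₀) (blockCovered x y p₀ q₀)
                                    ≡ x₀₀ x y * p₁ + x₀₁ x y * q₁ + h₀₀ x y * p₀ + h₀₁ x y * q₀
      two-step₁ : ∀ x y p₀ q₀ p₁ q₁ → columnFT x y p₁ q₁ (blockFree x y p₀ q₀) (blockCovered x y p₀ q₀)
                                    ≡ x₁₀ x y * p₁ + x₁₁ x y * q₁ + h₁₀ x y * p₀ + h₁₁ x y * q₀
      first₀ : ∀ x y → columnFF x y (+ 1) (+ 0) (+ 0) (+ 0) ≡ x₀₀ x y
      first₁ : ∀ x y → columnFT x y (+ 1) (+ 0) (+ 0) (+ 0) ≡ x₁₀ x y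
      second : ∀ x y →
        let U₃ = next x y
            U₂ = next U₃ x
        in x₀₀ x y * x₀₀ x y + x₀₁ x y * x₁₀ x y + h₀₀ x y * + 1 + h₀₁ x y * + 0
           ≡ U₂ * (U₂ * + 1) + A * B * x * U₃ + B * (U₃ * (U₃ * + 1)) + B * (B * + 1) * (x * (x * + 1))
      third : ∀ x y →
        let p₂ = x₀₀ x y * x₀₀ x y + x₀₁ x y * x₁₀ x y + h₀₀ x y * + 1 + h₀₁ x y * + 0
            q₂ = x₁₀ x y * x₀₀ x y + x₁₁ x y * x₁₀ x y + h₁₀ x y * + 1 + h₁₁ x y * + 0
            U₃ = next x y
            U₂ = next U₃ x
        in x₀₀ x y * p₂ + x₀₁ x y * q₂ + h₀₀ x y * x₀₀ x y + h₀₁ x y * x₁₀ x y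
           ≡ (U₂ * (U₂ * + 1) + + 2 * A * B * x * U₃ + + 2 * B * (U₃ * (U₃ * + 1))
              + + 2 * (B * (B * + 1)) * (x * (x * + 1))) * U₂
             + B * (B * + 1) * (U₃ * x + (A * A + B) * x * y + A * (x * (x * + 1))) * U₃
             + A * (B * (B * (B * + 1))) * (x * (x * + 1)) * y
      α₀ : A * A + B ≡ α-poly (+ 1) (+ 0)
      α₁ : A * (A * A + + 3 * B) ≡ α-poly (A * + 1 + B * + 0) (+ 1)
      α-step : ∀ x y → α-poly (next (next x y) x) (next x y) ≡ A * α-poly (next x y) x + B * α-poly x y
      β₀ : + 2 * B * (A * A + B) ≡ β-poly (+ 1) (+ 0)
      β₁ : B * (A * A + B) * (A * A + + 2 * B) ≡ β-poly (A * + 1 + B * + 0) (+ 1)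
      β₂ : B * (A * (A * (A * (A * (A * (A * + 1))))) + + 6 * (A * (A * (A * (A * + 1)))) * B
                + + 10 * (A * (A * + 1)) * (B * (B * + 1)) + + 2 * (B * (B * (B * + 1))))
           ≡ β-poly (next (A * + 1 + B * + 0) (+ 1)) (A * + 1 + B * + 0)
      β-step : ∀ x y →
        let x₁ = next x y
            x₂ = next x₁ x
            x₃ = next x₂ x₁
        in β-poly x₃ x₂ ≡ (A * A + B) * β-poly x₂ x₁ + B * (A * A + B) * β-poly x₁ x - B * (B * (B * + 1)) * β-poly x y
      γ₀ : B * (B * + 1) * (A * A - B) ≡ γ-poly (+ 1) (+ 0)
      γ₁ : - (A * (B * (B * (B * + 1))) * (A * A + B)) ≡ γ-poly (A * + 1 + B * + 0) (+ 1)
      γ-step : ∀ x y →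
        let x₁ = next x y
            x₂ = next x₁ x
        in γ-poly x₂ x₁ ≡ - (A * B) * γ-poly x₁ x + B * (B * (B * + 1)) * γ-poly x y
      cassini₀ : cassini (+ 1) (+ 0) ≡ + 1
      cassini-step : ∀ x y → cassini (next x y) x ≡ - B * cassini x y
      δ-cassini : ∀ x y → δ-poly x y ≡ B * B * B * B * (cassini x y * cassini x y)

  transferIdentities : ∀ A B → TransferIdentities A B
  transferIdentities A B = record
    { two-step₀    = λ x y p₀ q₀ p₁ q₁ → solve (A ∷ B ∷ x ∷ y ∷ p₀ ∷ q₀ ∷ p₁ ∷ q₁ ∷ [])
    ; two-step₁    = λ x y p₀ q₀ p₁ q₁ → solve (A ∷ B ∷ x ∷ y ∷ p₀ ∷ q₀ ∷ p₁ ∷ q₁ ∷ [])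
    ; first₀       = λ x y → solve (A ∷ B ∷ x ∷ y ∷ [])
    ; first₁       = λ x y → solve (A ∷ B ∷ x ∷ y ∷ [])
    ; second       = λ x y → solve (A ∷ B ∷ x ∷ y ∷ [])
    ; third        = λ x y → solve (A ∷ B ∷ x ∷ y ∷ [])
    ; α₀           = solve (A ∷ B ∷ [])
    ; α₁           = solve (A ∷ B ∷ [])
    ; α-step       = λ x y → solve (A ∷ B ∷ x ∷ y ∷ [])
    ; β₀           = solve (A ∷ B ∷ [])
    ; β₁           = solve (A ∷ B ∷ [])
    ; β₂           = solve (A ∷ B ∷ [])
    ; β-step       = λ x y → solve (A ∷ B ∷ x ∷ y ∷ [])
    ; γ₀           = solve (A ∷ B ∷ [])
    ; γ₁           = solve (A ∷ B ∷ [])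
    ; γ-step       = λ x y → solve (A ∷ B ∷ x ∷ y ∷ [])
    ; cassini₀     = solve (A ∷ B ∷ [])
    ; cassini-step = λ x y → solve (A ∷ B ∷ x ∷ y ∷ [])
    ; δ-cassini    = λ x y → solve (A ∷ B ∷ x ∷ y ∷ [])
    }

  module Transferℤ (a b : ℕ) where
    open Counting a b

    A B : ℤ
    A = + a
    B = + b

    pos-linear : ∀ p q → + (a ℕ.* p ℕ.+ b ℕ.* q) ≡ A * + p + B * + q
    pos-linear p q = trans (pos-+ (a ℕ.* p) (b ℕ.* q)) (cong₂ _+_ (pos-* a p) (pos-* b q))

    -- pathFrom at length L, with x = u L and y = u (L - 1)
    pathℤ : Bool → ℤ → ℤ → ℤ → ℤ → ℤ
    pathℤ false x y z₀ z₁ = x * z₀ + B * y * z₁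
    pathℤ true  x y z₀ z₁ = y * z₀ + (x - A * y) * z₁

    mutual
      pathFromFree-ℤ : ∀ L z₀ z₁ → + pathFromFree L z₀ z₁ ≡ pathℤ false (u A B L) (u₋ A B L) (+ z₀) (+ z₁)
      pathFromFree-ℤ zero    z₀ z₁ = base B (+ z₀) (+ z₁)
        where
        base : ∀ B z₀ z₁ → z₀ ≡ + 1 * z₀ + B * + 0 * z₁
        base = solve-∀
      pathFromFree-ℤ (suc L) z₀ z₁ = begin
        + (a ℕ.* pathFromFree L z₀ z₁ ℕ.+ b ℕ.* pathFromCovered L z₀ z₁)
          ≡⟨ pos-linear (pathFromFree L z₀ z₁) (pathFromCovered L z₀ z₁) ⟩
        A * + pathFromFree L z₀ z₁ + B * + pathFromCovered L z₀ z₁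
          ≡⟨ cong₂ (λ s t → A * s + B * t) (pathFromFree-ℤ L z₀ z₁) (pathFromCovered-ℤ L z₀ z₁) ⟩
        A * pathℤ false (u A B L) (u₋ A B L) (+ z₀) (+ z₁) + B * pathℤ true (u A B L) (u₋ A B L) (+ z₀) (+ z₁)
          ≡⟨ step A B (u A B L) (u₋ A B L) (+ z₀) (+ z₁) ⟩
        pathℤ false (u A B (suc L)) (u₋ A B (suc L)) (+ z₀) (+ z₁) ∎
        where
        step : ∀ A B x y z₀ z₁ → A * (x * z₀ + B * y * z₁) + B * (y * z₀ + (x - A * y) * z₁)
                                ≡ (A * x + B * y) * z₀ + B * x * z₁
        step = solve-∀

      pathFromCovered-ℤ : ∀ L z₀ z₁ → + pathFromCovered L z₀ z₁ ≡ pathℤ true (u A B L) (u₋ A B L) (+ z₀) (+ z₁)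
      pathFromCovered-ℤ zero    z₀ z₁ = base A (+ z₀) (+ z₁)
        where
        base : ∀ A z₀ z₁ → z₁ ≡ + 0 * z₀ + (+ 1 - A * + 0) * z₁
        base = solve-∀
      pathFromCovered-ℤ (suc L) z₀ z₁ =
        trans (pathFromFree-ℤ L z₀ z₁) (step A B (u A B L) (u₋ A B L) (+ z₀) (+ z₁))
        where
        step : ∀ A B x y z₀ z₁ → x * z₀ + B * y * z₁ ≡ x * z₀ + ((A * x + B * y) - A * x) * z₁
        step = solve-∀

    pathFrom-ℤ : ∀ t L z₀ z₁ → + pathFrom t L z₀ z₁ ≡ pathℤ t (u A B L) (u₋ A B L) (+ z₀) (+ z₁)
    pathFrom-ℤ false = pathFromFree-ℤ
    pathFrom-ℤ true  = pathFromCovered-ℤ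

    open TransferIdentities (transferIdentities A B) public

    αs-closed : ∀ k → αs A B k ≡ α-poly (u A B k) (u₋ A B k)
    αs-closed zero          = α₀
    αs-closed (suc zero)    = α₁
    αs-closed (suc (suc k)) =
      trans (cong₂ (λ s t → A * s + B * t) (αs-closed (suc k)) (αs-closed k)) (sym (α-step (u A B k) (u₋ A B k)))

    βs-closed : ∀ k → βs A B k ≡ β-poly (u A B k) (u₋ A B k)
    βs-closed zero                = β₀
    βs-closed (suc zero)          = β₁
    βs-closed (suc (suc zero))    = β₂
    βs-closed (suc (suc (suc k))) =
      trans (cong₂ (λ s t → s - B * (B * (B * + 1)) * t)
                   (cong₂ (λ s t → (A * A + B) * s + B * (A * A + B) * t) (βs-closed (suc (suc k))) (βs-closed (suc k)))
                   (βs-closed k))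
            (sym (β-step (u A B k) (u₋ A B k)))

    γs-closed : ∀ k → γs A B k ≡ γ-poly (u A B k) (u₋ A B k)
    γs-closed zero          = γ₀
    γs-closed (suc zero)    = γ₁
    γs-closed (suc (suc k)) =
      trans (cong₂ (λ s t → - (A * B) * s + B * (B * (B * + 1)) * t) (γs-closed (suc k)) (γs-closed k))
            (sym (γ-step (u A B k) (u₋ A B k)))

    cassini-closed : ∀ k → cassini (u A B k) (u₋ A B k) ≡ (- B) ^ k
    cassini-closed zero    = cassini₀
    cassini-closed (suc k) = trans (cassini-step (u A B k) (u₋ A B k)) (cong (- B *_) (cassini-closed k))

    B^2[1+k] : ∀ k → B ^ (2 ℕ.* suc k) ≡ B * (B * B ^ (2 ℕ.* k))
    B^2[1+k] k = cong (λ e → B * B ^ e) (+-suc k (k ℕ.+ 0))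

    [-B]^k² : ∀ k → (- B) ^ k * (- B) ^ k ≡ B ^ (2 ℕ.* k)
    [-B]^k² zero    = refl
    [-B]^k² (suc k) = begin
      (- B * (- B) ^ k) * (- B * (- B) ^ k) ≡⟨ square-neg B ((- B) ^ k) ⟩
      B * (B * ((- B) ^ k * (- B) ^ k))     ≡⟨ cong (λ t → B * (B * t)) ([-B]^k² k) ⟩
      B * (B * B ^ (2 ℕ.* k))               ≡⟨ sym (B^2[1+k] k) ⟩
      B ^ (2 ℕ.* suc k) ∎
      where
      square-neg : ∀ B P → (- B * P) * (- B * P) ≡ B * (B * (P * P))
      square-neg = solve-∀

    δ-closed : ∀ k → δ-poly (u A B k) (u₋ A B k) ≡ B ^ (2 ℕ.* suc (suc k))
    δ-closed k = begin
      δ-poly (u A B k) (u₋ A B k)                                ≡⟨ δ-cassini (u A B k) (u₋ A B k) ⟩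
      B * B * B * B * (cassini (u A B k) (u₋ A B k) * cassini (u A B k) (u₋ A B k))
        ≡⟨ cong (λ c → B * B * B * B * (c * c)) (cassini-closed k) ⟩
      B * B * B * B * ((- B) ^ k * (- B) ^ k)                     ≡⟨ cong (B * B * B * B *_) ([-B]^k² k) ⟩
      B * B * B * B * B ^ (2 ℕ.* k)                               ≡⟨ reassociate B (B ^ (2 ℕ.* k)) ⟩
      B * (B * (B * (B * B ^ (2 ℕ.* k))))                         ≡⟨ cong (λ t → B * (B * t)) (sym (B^2[1+k] k)) ⟩
      B * (B * B ^ (2 ℕ.* suc k))                                 ≡⟨ sym (B^2[1+k] (suc k)) ⟩
      B ^ (2 ℕ.* suc (suc k)) ∎
      where
      reassociate : ∀ B P → B * B * B * B * P ≡ B * (B * (B * (B * P)))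
      reassociate = solve-∀

    module Orbit (m′ : ℕ) where
      open Transfer a b m′ using (block; W)

      x y : ℤ
      x = u A B m′
      y = u₋ A B m′

      X H : Matrix₂
      X = transferX x y
      H = transferH x y

      p q : ℕ → ℤ
      p k = proj₁ (orbit X H k)
      q k = proj₂ (orbit X H k)

      P Q : ℕ → ℤ
      P k = + W k false false
      Q k = + W k false true

      block-ℤ : ∀ w t s′ → + block w t s′ ≡ pathℤ t x y (A * + w s′ false + B * + w s′ true) (+ w s′ false)
      block-ℤ w t s′ = trans (pathFrom-ℤ t m′ _ _) (cong (λ z → pathℤ t x y z (+ w s′ false)) (pos-linear _ _))

      W-true : ∀ k t → + W (suc k) true t ≡ pathℤ t x y (A * P k + B * Q k) (P k)
      W-true k t = block-ℤ (W k) t false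

      P-suc : ∀ k → P (suc k) ≡ columnFF x y (P k) (Q k) (+ W k true false) (+ W k true true)
      P-suc k = begin
        + (a ℕ.* block w false false ℕ.+ b ℕ.* block w false true ℕ.+ b ℕ.* block w true false)
          ≡⟨ trans (pos-+ (a ℕ.* block w false false ℕ.+ b ℕ.* block w false true) (b ℕ.* block w true false))
                   (cong₂ _+_ (pos-linear (block w false false) (block w false true)) (pos-* b (block w true false))) ⟩
        A * + block w false false + B * + block w false true + B * + block w true false
          ≡⟨ cong₂ _+_ (cong₂ (λ s t → A * s + B * t) (block-ℤ w false false) (block-ℤ w false true))
                       (cong (B *_) (block-ℤ w true false)) ⟩
        columnFF x y (P k) (Q k) (+ W k true false) (+ W k true true) ∎
        where
        w = W k

      Q-suc : ∀ k → Q (suc k) ≡ columnFT x y (P k) (Q k) (+ W k true false) (+ W k true true)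
      Q-suc k = trans (pos-linear _ _) (cong₂ (λ s t → A * s + B * t) (block-ℤ (W k) true false) (block-ℤ (W k) true true))

      P-two-step : ∀ k → P (2 ℕ.+ k) ≡ x₀₀ x y * P (suc k) + x₀₁ x y * Q (suc k) + h₀₀ x y * P k + h₀₁ x y * Q k
      P-two-step k =
        trans (P-suc (suc k))
          (trans (cong₂ (columnFF x y (P (suc k)) (Q (suc k))) (W-true k false) (W-true k true))
                 (two-step₀ x y (P k) (Q k) (P (suc k)) (Q (suc k))))

      Q-two-step : ∀ k → Q (2 ℕ.+ k) ≡ x₁₀ x y * P (suc k) + x₁₁ x y * Q (suc k) + h₁₀ x y * P k + h₁₁ x y * Q k
      Q-two-step k =
        trans (Q-suc (suc k))
          (trans (cong₂ (columnFT x y (P (suc k)) (Q (suc k))) (W-true k false) (W-true k true))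
                 (two-step₁ x y (P k) (Q k) (P (suc k)) (Q (suc k))))

      combination-cong : ∀ c₁ c₂ c₃ c₄ {p₁ q₁ p₀ q₀ p₁′ q₁′ p₀′ q₀′} →
                         p₁ ≡ p₁′ → q₁ ≡ q₁′ → p₀ ≡ p₀′ → q₀ ≡ q₀′ →
                         c₁ * p₁ + c₂ * q₁ + c₃ * p₀ + c₄ * q₀ ≡ c₁ * p₁′ + c₂ * q₁′ + c₃ * p₀′ + c₄ * q₀′
      combination-cong c₁ c₂ c₃ c₄ refl refl refl refl = refl

      W-orbit : ∀ k → (P k ≡ p k × Q k ≡ q k) × (P (suc k) ≡ p (suc k) × Q (suc k) ≡ q (suc k))
      W-orbit zero    = (refl , refl) , (trans (P-suc 0) (first₀ x y) , trans (Q-suc 0) (first₁ x y))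
      W-orbit (suc k) with W-orbit k
      ... | (P₀ , Q₀) , (P₁ , Q₁) =
        (P₁ , Q₁) , (trans (P-two-step k) (combination-cong (x₀₀ x y) (x₀₁ x y) (h₀₀ x y) (h₀₁ x y) P₁ Q₁ P₀ Q₀) ,
                     trans (Q-two-step k) (combination-cong (x₁₀ x y) (x₁₁ x y) (h₁₀ x y) (h₁₁ x y) P₁ Q₁ P₀ Q₀))

  module Recurrence (a b m′ : ℕ) where
    open Transferℤ a b public
    open Orbit m′ public

    R-orbit : ∀ k → Rℤ a b (4 ℕ.+ m′) k ≡ p k
    R-orbit zero    = refl
    R-orbit (suc k) = trans (cong +_ (R≡W a b m′ k)) (proj₁ (proj₁ (W-orbit (suc k))))

    R-orbit′ : ∀ n j → Rℤ a b (4 ℕ.+ m′) (n ℕ.+ j) ≡ p (j ℕ.+ n)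
    R-orbit′ n j = trans (R-orbit (n ℕ.+ j)) (cong p (+-comm n j))

    recurrence : ∀ n → Rℤ a b (4 ℕ.+ m′) (n ℕ.+ 4) ≡
        α A B (4 ℕ.+ m′) * Rℤ a b (4 ℕ.+ m′) (n ℕ.+ 3) + β A B (4 ℕ.+ m′) * Rℤ a b (4 ℕ.+ m′) (n ℕ.+ 2)
        + γ A B (4 ℕ.+ m′) * Rℤ a b (4 ℕ.+ m′) (n ℕ.+ 1) - B ^ (2 ℕ.* (4 ℕ.+ m′ ℕ.∸ 2)) * Rℤ a b (4 ℕ.+ m′) n
    recurrence n = begin
      Rℤ a b (4 ℕ.+ m′) (n ℕ.+ 4)  ≡⟨ R-orbit′ n 4 ⟩
      p (4 ℕ.+ n)                   ≡⟨ cayley-hamilton₂ X H p q (λ _ → refl) (λ _ → refl) n ⟩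
      trace X * p (3 ℕ.+ n) + (trace H - det X) * p (2 ℕ.+ n) + (- mixedDet X H) * p (1 ℕ.+ n) - det H * p n
        ≡⟨ cong₂ _-_ (cong₂ _+_ (cong₂ _+_ (cong₂ _*_ (sym (αs-closed m′)) (sym (R-orbit′ n 3)))
                                            (cong₂ _*_ (sym (βs-closed m′)) (sym (R-orbit′ n 2))))
                                 (cong₂ _*_ (sym (γs-closed m′)) (sym (R-orbit′ n 1))))
                     (cong₂ _*_ (δ-closed m′) (sym (R-orbit n))) ⟩
      α A B (4 ℕ.+ m′) * Rℤ a b (4 ℕ.+ m′) (n ℕ.+ 3) + β A B (4 ℕ.+ m′) * Rℤ a b (4 ℕ.+ m′) (n ℕ.+ 2)
        + γ A B (4 ℕ.+ m′) * Rℤ a b (4 ℕ.+ m′) (n ℕ.+ 1) - B ^ (2 ℕ.* (4 ℕ.+ m′ ℕ.∸ 2)) * Rℤ a b (4 ℕ.+ m′) n ∎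

open import Defs
open import Data.Nat using (ℕ; _≤_; _+_; _*_; _∸_; zero; suc; s≤s)
open import Data.Integer as ℤ using (ℤ; +_)
open import Data.Product using (_×_; _,_)
open import Relation.Binary.PropositionalEquality using (_≡_; refl; trans)
open IntegerCounts using (module Recurrence)

theorem1 : (q a b : ℕ) → 4 ≤ q → 1 ≤ a → 1 ≤ b →
    ((n : ℕ) → Rℤ a b q (n + 4) ≡
        α (+ a) (+ b) q ℤ.* Rℤ a b q (n + 3) ℤ.+ β (+ a) (+ b) q ℤ.* Rℤ a b q (n + 2)
        ℤ.+ γ (+ a) (+ b) q ℤ.* Rℤ a b q (n + 1) ℤ.- (+ b) ℤ.^ (2 * (q ∸ 2)) ℤ.* Rℤ a b q n)
  × R a b q 0 ≡ 1
  × Rℤ a b q 1 ≡ u (+ a) (+ b) (q ∸ 2)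
  × Rℤ a b q 2 ≡ u (+ a) (+ b) (q ∸ 2) ℤ.^ 2 ℤ.+ (+ a) ℤ.* (+ b) ℤ.* u (+ a) (+ b) (q ∸ 4) ℤ.* u (+ a) (+ b) (q ∸ 3)
           ℤ.+ (+ b) ℤ.* u (+ a) (+ b) (q ∸ 3) ℤ.^ 2 ℤ.+ (+ b) ℤ.^ 2 ℤ.* u (+ a) (+ b) (q ∸ 4) ℤ.^ 2
  × Rℤ a b q 3 ≡ (u (+ a) (+ b) (q ∸ 2) ℤ.^ 2 ℤ.+ + 2 ℤ.* (+ a) ℤ.* (+ b) ℤ.* u (+ a) (+ b) (q ∸ 4) ℤ.* u (+ a) (+ b) (q ∸ 3)
             ℤ.+ + 2 ℤ.* (+ b) ℤ.* u (+ a) (+ b) (q ∸ 3) ℤ.^ 2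
             ℤ.+ + 2 ℤ.* (+ b) ℤ.^ 2 ℤ.* u (+ a) (+ b) (q ∸ 4) ℤ.^ 2) ℤ.* u (+ a) (+ b) (q ∸ 2)
           ℤ.+ (+ b) ℤ.^ 2 ℤ.* (u (+ a) (+ b) (q ∸ 3) ℤ.* u (+ a) (+ b) (q ∸ 4)
                 ℤ.+ ((+ a) ℤ.* (+ a) ℤ.+ (+ b)) ℤ.* u (+ a) (+ b) (q ∸ 4) ℤ.* u₋ (+ a) (+ b) (q ∸ 4)
                 ℤ.+ (+ a) ℤ.* u (+ a) (+ b) (q ∸ 4) ℤ.^ 2) ℤ.* u (+ a) (+ b) (q ∸ 3)
           ℤ.+ (+ a) ℤ.* (+ b) ℤ.^ 3 ℤ.* u (+ a) (+ b) (q ∸ 4) ℤ.^ 2 ℤ.* u₋ (+ a) (+ b) (q ∸ 4)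
theorem1 (suc (suc (suc (suc m′)))) a b _ _ _ =
  recurrence , refl , R-orbit 1 , trans (R-orbit 2) (second x y) , trans (R-orbit 3) (third x y)
  where open Recurrence a b m′
theorem1 0                   a b ()                      _ _
theorem1 1                   a b (s≤s ())                _ _
theorem1 2                   a b (s≤s (s≤s ()))          _ _
theorem1 3                   a b (s≤s (s≤s (s≤s ())))    _ _
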